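{- Let $n\ge 1$ and let $G$ be the unit interval graph on vertex set $[n]$ determined by intervals $[a_1,1],[a_2,2],\ldots,[a_n,n]$ (integers $1\le a_k\le k$). Let $G'$ be the graph on $[n-1]$ obtained from $G$ by removing vertex $n$. Then $$Y_G=Y_{G'}Y_{K_1}-\sum_{i=a_n}^{n-1}Y_{G'}\uparrow_i^n=Y_{G'}\uparrow_n^n-\sum_{i=a_n}^{n-1}Y_{G'}\uparrow_i^n .$$
   Context: Unit interval graph: given integer intervals $[a_1,1],\ldots,[a_n,n]$ with $1\le a_k\le k$ (where $[a,b]=\{a,a+1,\ldots,b\}$), the graph on $[n]=\{1,\ldots,n\}$ in which distinct $i,j$ are adjacent iff $i,j\in[a_k,k]$ for some $k$. Let $x_1,x_2,\ldots$ be non-commuting variables. For a simple graph $H$ with vertex set $[N]$, the chromatic symmetric function in non-commuting variables is $Y_H=\sum_\kappa x_{\kappa(1)}x_{\kappa(2)}\cdots x_{\kappa(N)}$, summed over proper colorings $\kappa:[N]\to\{1,2,\ldots\}$ (adjacent vertices get different colors). $K_1$ is the one-vertex graph, so $Y_{K_1}=p_1=x_1+x_2+\cdots$. Induction: for $1\le j<N$ and a monomial, $x_{i_1}\cdots x_{i_{N-1}}\uparrow_j^N=x_{i_1}\cdots x_{i_{N-1}}x_{i_j}$ (append a copy of the $j$-th variable), extended linearly; and $f\uparrow_N^N=f\,p_1$. When $n=1$, $G'$ is the graph with no vertices, $Y_{G'}=1$, and the sum is empty. -}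

module Defs where

open import Data.Bool using (Bool; true; false; _∧_; _∨_; not; if_then_else_)
open import Data.Nat using (ℕ; zero; suc; _∸_; _≡ᵇ_; _≤ᵇ_) renaming (_+_ to _+ℕ_)
open import Data.Nat.Properties using (_≟_)
open import Data.Fin using (Fin; toℕ; inject₁; cast; _≟_)
open import Data.List using (List; []; _∷_; length; lookup; map; foldr; allFin; upTo; unsnoc; concatMap)
open import Data.Bool.ListAction using (all; any)
open import Data.Maybe using (Maybe; just; nothing)
open import Data.Product using (_×_; _,_; proj₁; proj₂)
open import Data.Integer using (ℤ; 0ℤ; 1ℤ; _+_; _*_; _-_)
open import Relation.Nullary using (yes; no; does)
open import Relation.Binary.PropositionalEquality using (_≡_; sym)

-- A (formal) power series in the non-commuting variables x_0, x_1, x_2, ...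
-- (variable x_c is indexed by c : ℕ) with integer coefficients:
-- the coefficient of the monomial (word) x_{c1} x_{c2} ... x_{ck} is  f (c1 ∷ ... ∷ ck ∷ []).
NCSeries : Set
NCSeries = List ℕ → ℤ

infix 4 _≈_
_≈_ : NCSeries → NCSeries → Set
f ≈ g = ∀ w → f w ≡ g w

sumℤ : List ℤ → ℤ
sumℤ = foldr _+_ 0ℤ

splits : List ℕ → List (List ℕ × List ℕ)
splits []       = ([] , []) ∷ []
splits (x ∷ xs) = ([] , x ∷ xs) ∷ map (λ p → (x ∷ proj₁ p , proj₂ p)) (splits xs)

infixl 7 _·_
_·_ : NCSeries → NCSeries → NCSeries
(f · g) w = sumℤ (map (λ p → f (proj₁ p) * g (proj₂ p)) (splits w))

infixl 6 _⊖_
_⊖_ : NCSeries → NCSeries → NCSeries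
(f ⊖ g) w = f w - g w

Σs : List NCSeries → NCSeries
Σs fs w = sumℤ (map (λ f → f w) fs)

interval : ℕ → ℕ → List ℕ
interval lo hi = map (lo +ℕ_) (upTo (suc hi ∸ lo))

p₁ : NCSeries
p₁ (c ∷ []) = 1ℤ
p₁ _        = 0ℤ

nth : List ℕ → ℕ → Maybe ℕ
nth []       _       = nothing
nth (x ∷ xs) zero    = just x
nth (x ∷ xs) (suc k) = nth xs k

eqMaybe : Maybe ℕ → ℕ → Bool
eqMaybe (just x) c = x ≡ᵇ c
eqMaybe nothing  c = false

-- induction  f ↑_j^N  for 1 ≤ j < N (1-based j), applied to a series f
-- (meant for f homogeneous of degree N-1): the monomial u of degree N-1 is sent
-- to u x_{u_j}; i.e. the coefficient of a word u ++ [c] with |u| = N-1 is f u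
-- if the j-th letter of u is c, and 0 otherwise.
upLt : ℕ → ℕ → NCSeries → NCSeries
upLt j N f w with unsnoc w
... | nothing      = 0ℤ
... | just (u , c) = if (length u ≡ᵇ N ∸ 1) ∧ eqMaybe (nth u (j ∸ 1)) c then f u else 0ℤ

up : ℕ → ℕ → NCSeries → NCSeries
up j N f = if j ≡ᵇ N then f · p₁ else upLt j N f

-- simple graphs on vertex set Fin N (vertex i ∈ Fin N stands for i+1 ∈ [N])
record Graph (N : ℕ) : Set where
  field adj : Fin N → Fin N → Bool
open Graph public

properᵇ : {N : ℕ} → Graph N → (Fin N → ℕ) → Bool
properᵇ {N} H κ =
  all (λ i → all (λ j → does (i Data.Fin.≟ j) ∨ not (adj H i j) ∨ not (κ i ≡ᵇ κ j)) (allFin N)) (allFin N)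

-- chromatic symmetric function in non-commuting variables:
-- coefficient of the word κ(1)…κ(N) is 1 if κ is proper, 0 otherwise,
-- and words of length ≠ N have coefficient 0.
Y : {N : ℕ} → Graph N → NCSeries
Y {N} H w with length w Data.Nat.Properties.≟ N
... | no _  = 0ℤ
... | yes p = if properᵇ H (λ i → lookup w (cast (sym p) i)) then 1ℤ else 0ℤ

-- unit interval graph on [n] from a : Fin n → ℕ, where a k = a_{k+1} (1-based values);
-- distinct i, j adjacent iff both lie in [a_k, k] for some k.
UIG : (n : ℕ) → (Fin n → ℕ) → Graph n
adj (UIG n a) i j =
  not (does (i Data.Fin.≟ j)) ∧
  any (λ k → (a k ≤ᵇ suc (toℕ i)) ∧ (suc (toℕ i) ≤ᵇ suc (toℕ k))
           ∧ (a k ≤ᵇ suc (toℕ j)) ∧ (suc (toℕ j) ≤ᵇ suc (toℕ k))) (allFin n)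

deleteLast : {N : ℕ} → Graph (suc N) → Graph N
adj (deleteLast H) i j = adj H (inject₁ i) (inject₁ j)

K₁ : Graph 1
adj K₁ _ _ = false

module Submission where

-- Compare coefficients of words u x_c with |u| = n − 1; every other word has coefficient 0
-- on both sides.  The colouring of G read off from u x_c is proper iff the colouring of G′
-- read off from u is proper and c differs from the colours of the neighbours a_n, …, n − 1
-- of vertex n.  These neighbours lie in the interval [a_n, n], so they form a clique and a
-- proper colouring of G′ uses c at most once among them.  Hence the coefficient of u x_c in
-- Y_G is that of u in Y_G′ times 1 − #{i ∈ [a_n, n − 1] : u_i = c}, and the subtracted part
-- is exactly the coefficient of u x_c in Σ_i Y_G′↑_i^n, while Y_G′ Y_K₁ = Y_G′↑_n^n
-- contributes the coefficient of u in Y_G′.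

open import Defs
open import Data.Bool using (Bool; true; false; _∧_; _∨_; not; if_then_else_; T)
open import Data.Bool.ListAction using (all; any)
open import Data.Bool.Properties using (T-∧; T-≡)
open import Data.Empty using (⊥-elim)
open import Data.Fin using (Fin; toℕ; fromℕ; fromℕ<; inject₁; cast; _≟_)
import Data.Fin.Properties as Finₚ
open import Data.Fin.Relation.Unary.Top using (view; ‵fromℕ; ‵inject₁)
open import Data.Integer using (ℤ; 0ℤ; 1ℤ; _+_; _*_; _-_)
import Data.Integer.Properties as ℤₚ
open import Data.List using (List; []; _∷_; _++_; _∷ʳ_; length; map; allFin; lookup; unsnoc; initLast; _∷ʳ′_)
import Data.List.Properties as Listₚ
open import Data.List.Membership.Propositional using (_∈_; find; lose)
open import Data.List.Membership.Propositional.Properties using (∈-allFin; ∈-upTo⁺; ∈-upTo⁻; ∈-map⁺; ∈-map⁻)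
import Data.List.Relation.Unary.All as All
open import Data.List.Relation.Unary.All.Properties using (all⁺; all⁻)
open import Data.List.Relation.Unary.Any using (here; there)
open import Data.List.Relation.Unary.Any.Properties using (any⁺; any⁻)
open import Data.List.Relation.Unary.AllPairs using (_∷_)
open import Data.List.Relation.Unary.Unique.Propositional using (Unique)
import Data.List.Relation.Unary.Unique.Propositional.Properties as Uniqueₚ
open import Data.Maybe using (just)
open import Data.Maybe.Properties using (just-injective)
open import Data.Nat using (ℕ; zero; suc; _≤_; _<_; _∸_; _≡ᵇ_; s≤s; s≤s⁻¹) renaming (_+_ to _+ℕ_)
import Data.Nat.Properties as ℕₚ
open import Data.Product using (_×_; _,_; proj₁; proj₂; ∃)
open import Data.Unit using (tt)
open import Function using (_∘_; _⇔_; mk⇔; Equivalence)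
open import Relation.Nullary using (¬_; Dec; yes; no; does)
open import Relation.Nullary.Decidable using (dec-true; dec-false)
open import Relation.Binary.PropositionalEquality
open ≡-Reasoning

⟦_⟧ : Bool → ℤ
⟦ b ⟧ = if b then 1ℤ else 0ℤ

T-ext : ∀ {a b} → (T a → T b) → (T b → T a) → a ≡ b
T-ext {false} {false} _ _ = refl
T-ext {false} {true}  _ g = ⊥-elim (g tt)
T-ext {true}  {false} f _ = ⊥-elim (f tt)
T-ext {true}  {true}  _ _ = refl

T-∧-not⁺ : ∀ {a b} → T b → ¬ T a → T (b ∧ not a)
T-∧-not⁺ {false} tb _  = Equivalence.from T-∧ (tb , tt)
T-∧-not⁺ {true}  _  ¬a = ⊥-elim (¬a tt)

T-∧-not⁻ : ∀ {a b} → T (b ∧ not a) → T b × ¬ T a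
T-∧-not⁻ {false} t = proj₁ (Equivalence.to T-∧ t) , λ ()
T-∧-not⁻ {true} {false} ()
T-∧-not⁻ {true} {true}  ()

⟦∧not⟧ : ∀ a b {s : ℤ} → (T b → s ≡ ⟦ a ⟧) → ⟦ b ∧ not a ⟧ ≡ ⟦ b ⟧ - s * ⟦ b ⟧
⟦∧not⟧ a     false {s} _ = cong (0ℤ -_) (sym (ℤₚ.*-zeroʳ s))
⟦∧not⟧ false true      h rewrite h tt = refl
⟦∧not⟧ true  true      h rewrite h tt = refl

if-then-0ℤ : ∀ b x → (if b then x else 0ℤ) ≡ ⟦ b ⟧ * x
if-then-0ℤ true  x = sym (ℤₚ.*-identityˡ x)
if-then-0ℤ false x = sym (ℤₚ.*-zeroˡ x)

≡ᵇ-refl : ∀ n → (n ≡ᵇ n) ≡ true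
≡ᵇ-refl zero    = refl
≡ᵇ-refl (suc n) = ≡ᵇ-refl n

sumℤ-cong : ∀ {A : Set} {f g : A → ℤ} xs → (∀ {x} → x ∈ xs → f x ≡ g x) →
            sumℤ (map f xs) ≡ sumℤ (map g xs)
sumℤ-cong xs f≡g = cong sumℤ (Listₚ.map-cong-local (All.tabulate f≡g))

sumℤ-zero : ∀ {A : Set} {f : A → ℤ} xs → (∀ {x} → x ∈ xs → f x ≡ 0ℤ) → sumℤ (map f xs) ≡ 0ℤ
sumℤ-zero []       _   = refl
sumℤ-zero (x ∷ xs) f≡0 = cong₂ _+_ (f≡0 (here refl)) (sumℤ-zero xs (f≡0 ∘ there))

sumℤ-*ʳ : ∀ {A : Set} (f : A → ℤ) x xs → sumℤ (map (λ i → f i * x) xs) ≡ sumℤ (map f xs) * x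
sumℤ-*ʳ f x []       = sym (ℤₚ.*-zeroˡ x)
sumℤ-*ʳ f x (i ∷ xs) =
  trans (cong (f i * x +_) (sumℤ-*ʳ f x xs)) (sym (ℤₚ.*-distribʳ-+ x (f i) (sumℤ (map f xs))))

sumℤ-⟦⟧≡⟦any⟧ : ∀ {A : Set} (e : A → Bool) {xs} → Unique xs →
                (∀ {x y} → x ∈ xs → y ∈ xs → T (e x) → T (e y) → x ≡ y) →
                sumℤ (map (⟦_⟧ ∘ e) xs) ≡ ⟦ any e xs ⟧
sumℤ-⟦⟧≡⟦any⟧ e {[]}     _                 _         = refl
sumℤ-⟦⟧≡⟦any⟧ e {x ∷ xs} (x∉xs ∷ unique) atMostOne with e x in ex
... | true  = cong (1ℤ +_) (sumℤ-zero xs others-false)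
  where
  others-false : ∀ {y} → y ∈ xs → ⟦ e y ⟧ ≡ 0ℤ
  others-false {y} y∈xs with e y in ey
  ... | true  = ⊥-elim (All.lookup x∉xs y∈xs
                  (atMostOne (here refl) (there y∈xs) (Equivalence.from T-≡ ex) (Equivalence.from T-≡ ey)))
  ... | false = refl
... | false = trans (ℤₚ.+-identityˡ _)
                (sumℤ-⟦⟧≡⟦any⟧ e unique (λ x∈ y∈ → atMostOne (there x∈) (there y∈)))

Σs-map : ∀ {A : Set} (h : A → NCSeries) xs w → Σs (map h xs) w ≡ sumℤ (map (λ i → h i w) xs)
Σs-map h xs w = cong sumℤ (sym (Listₚ.map-∘ xs))

∈-interval⁻ : ∀ {lo hi i} → i ∈ interval lo hi → lo ≤ i × i ≤ hi
∈-interval⁻ {lo} {hi} i∈ with ∈-map⁻ (lo +ℕ_) i∈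
... | t , t∈ , refl = ℕₚ.m≤m+n lo t , s≤s⁻¹ lo+t<1+hi
  where
  t<1+hi∸lo : t < suc hi ∸ lo
  t<1+hi∸lo = ∈-upTo⁻ t∈
  lo+t<1+hi : lo +ℕ t < suc hi
  lo+t<1+hi = subst (lo +ℕ t <_)
    (ℕₚ.m+[n∸m]≡n (ℕₚ.<⇒≤ (ℕₚ.m∸n≢0⇒n<m {suc hi} {lo} (ℕₚ.m<n⇒n≢0 t<1+hi∸lo))))
    (ℕₚ.+-monoʳ-< lo t<1+hi∸lo)

∈-interval⁺ : ∀ {lo hi i} → lo ≤ i → i ≤ hi → i ∈ interval lo hi
∈-interval⁺ {lo} lo≤i i≤hi = subst (_∈ _) (ℕₚ.m+[n∸m]≡n lo≤i)
  (∈-map⁺ (lo +ℕ_) (∈-upTo⁺ (ℕₚ.∸-monoˡ-< (s≤s i≤hi) lo≤i)))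

interval-unique : ∀ lo hi → Unique (interval lo hi)
interval-unique lo hi = Uniqueₚ.map⁺ (ℕₚ.+-cancelˡ-≡ lo _ _) (Uniqueₚ.upTo⁺ _)

initLast-∷ʳ : ∀ {A : Set} (u : List A) c → initLast (u ∷ʳ c) ≡ u ∷ʳ′ c
initLast-∷ʳ []      c = refl
initLast-∷ʳ (x ∷ u) c rewrite initLast-∷ʳ u c = refl

unsnoc-∷ʳ : ∀ {A : Set} (u : List A) c → unsnoc (u ∷ʳ c) ≡ just (u , c)
unsnoc-∷ʳ u c rewrite initLast-∷ʳ u c = refl

length-∷ʳ : ∀ {A : Set} (u : List A) c → length (u ∷ʳ c) ≡ suc (length u)
length-∷ʳ u c = trans (Listₚ.length-++ u) (ℕₚ.+-comm (length u) 1)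

nth-lookup : ∀ w (k : Fin (length w)) → nth w (toℕ k) ≡ just (lookup w k)
nth-lookup (x ∷ w) Fin.zero    = refl
nth-lookup (x ∷ w) (Fin.suc k) = nth-lookup w k

nth-++ˡ : ∀ u v {k} → k < length u → nth (u ++ v) k ≡ nth u k
nth-++ˡ (x ∷ u) v {zero}  _   = refl
nth-++ˡ (x ∷ u) v {suc k} k<∣u∣ = nth-++ˡ u v (s≤s⁻¹ k<∣u∣)

nth-∷ʳ-length : ∀ u c → nth (u ∷ʳ c) (length u) ≡ just c
nth-∷ʳ-length []      c = refl
nth-∷ʳ-length (x ∷ u) c = nth-∷ʳ-length u c

colouring : ∀ {N} (w : List ℕ) → length w ≡ N → Fin N → ℕ
colouring w p i = lookup w (cast (sym p) i)

nth-colouring : ∀ {N} w (p : length w ≡ N) i → nth w (toℕ i) ≡ just (colouring w p i)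
nth-colouring w p i = trans (cong (nth w) (sym (Finₚ.toℕ-cast (sym p) i))) (nth-lookup w (cast (sym p) i))

module _ (u : List ℕ) (c : ℕ) {m} (p : length u ≡ m) (q : length (u ∷ʳ c) ≡ suc m) where

  colouring-∷ʳ-inject₁ : ∀ j → colouring (u ∷ʳ c) q (inject₁ j) ≡ colouring u p j
  colouring-∷ʳ-inject₁ j = just-injective (begin
    just (colouring (u ∷ʳ c) q (inject₁ j)) ≡⟨ sym (nth-colouring (u ∷ʳ c) q (inject₁ j)) ⟩
    nth (u ∷ʳ c) (toℕ (inject₁ j))          ≡⟨ cong (nth (u ∷ʳ c)) (Finₚ.toℕ-inject₁ j) ⟩
    nth (u ∷ʳ c) (toℕ j)                    ≡⟨ nth-++ˡ u (c ∷ []) (subst (toℕ j <_) (sym p) (Finₚ.toℕ<n j)) ⟩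
    nth u (toℕ j)                           ≡⟨ nth-colouring u p j ⟩
    just (colouring u p j)                  ∎)

  colouring-∷ʳ-fromℕ : colouring (u ∷ʳ c) q (fromℕ m) ≡ c
  colouring-∷ʳ-fromℕ = just-injective (begin
    just (colouring (u ∷ʳ c) q (fromℕ m)) ≡⟨ sym (nth-colouring (u ∷ʳ c) q (fromℕ m)) ⟩
    nth (u ∷ʳ c) (toℕ (fromℕ m))          ≡⟨ cong (nth (u ∷ʳ c)) (trans (Finₚ.toℕ-fromℕ m) (sym p)) ⟩
    nth (u ∷ʳ c) (length u)               ≡⟨ nth-∷ʳ-length u c ⟩
    just c                                ∎)

·-[] : ∀ f g → (f · g) [] ≡ f [] * g []
·-[] f g = ℤₚ.+-identityʳ _

·-∷ : ∀ f g x w → (f · g) (x ∷ w) ≡ f [] * g (x ∷ w) + ((λ v → f (x ∷ v)) · g) w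
·-∷ f g x w = cong (f [] * g (x ∷ w) +_) (cong sumℤ (sym (Listₚ.map-∘ (splits w))))

·-congʳ : ∀ f {g h} → g ≈ h → f · g ≈ f · h
·-congʳ f g≈h w = cong sumℤ (Listₚ.map-cong (λ (u , v) → cong (f u *_) (g≈h v)) (splits w))

p₁-∷-∷ʳ : ∀ x u c → p₁ (x ∷ (u ∷ʳ c)) ≡ 0ℤ
p₁-∷-∷ʳ x []      c = refl
p₁-∷-∷ʳ x (_ ∷ _) c = refl

·p₁-∷ʳ : ∀ f u c → (f · p₁) (u ∷ʳ c) ≡ f u
·p₁-∷ʳ f [] c = begin
  (f · p₁) (c ∷ [])                        ≡⟨ ·-∷ f p₁ c [] ⟩
  f [] * 1ℤ + ((λ v → f (c ∷ v)) · p₁) []  ≡⟨ cong₂ _+_ (ℤₚ.*-identityʳ (f []))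
                                                (trans (·-[] (λ v → f (c ∷ v)) p₁) (ℤₚ.*-zeroʳ (f (c ∷ [])))) ⟩
  f [] + 0ℤ                                ≡⟨ ℤₚ.+-identityʳ (f []) ⟩
  f []                                     ∎
·p₁-∷ʳ f (x ∷ u) c = begin
  (f · p₁) (x ∷ (u ∷ʳ c))                                         ≡⟨ ·-∷ f p₁ x (u ∷ʳ c) ⟩
  f [] * p₁ (x ∷ (u ∷ʳ c)) + ((λ v → f (x ∷ v)) · p₁) (u ∷ʳ c)  ≡⟨ cong₂ _+_
      (trans (cong (f [] *_) (p₁-∷-∷ʳ x u c)) (ℤₚ.*-zeroʳ (f []))) (·p₁-∷ʳ (λ v → f (x ∷ v)) u c) ⟩
  0ℤ + f (x ∷ u)                                                  ≡⟨ ℤₚ.+-identityˡ _ ⟩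
  f (x ∷ u)                                                       ∎

Y-K₁≈p₁ : Y K₁ ≈ p₁
Y-K₁≈p₁ []          = refl
Y-K₁≈p₁ (_ ∷ [])    = refl
Y-K₁≈p₁ (_ ∷ _ ∷ _) = refl

hasLetter : List ℕ → ℕ → ℕ → Bool
hasLetter u c i = eqMaybe (nth u (i ∸ 1)) c

upLt-∷ʳ : ∀ j N f u c →
          upLt j N f (u ∷ʳ c) ≡ (if (length u ≡ᵇ N ∸ 1) ∧ hasLetter u c j then f u else 0ℤ)
upLt-∷ʳ j N f u c rewrite unsnoc-∷ʳ u c = refl

up-diag : ∀ N f → up N N f ≈ f · p₁
up-diag N f w rewrite ≡ᵇ-refl N = refl

up-below : ∀ {i N} f → i < N → up i N f ≈ upLt i N f
up-below {i} {N} f i<N w with i ≡ᵇ N in eq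
... | true  = ⊥-elim (ℕₚ.<⇒≢ i<N (ℕₚ.≡ᵇ⇒≡ i N (Equivalence.from T-≡ eq)))
... | false = refl

up-[] : ∀ i N f → up i N f [] ≡ 0ℤ
up-[] i N f with i ≡ᵇ N
... | true  = trans (·-[] f p₁) (ℤₚ.*-zeroʳ (f []))
... | false = refl

·Y-K₁≈up-diag : ∀ N f → f · Y K₁ ≈ up N N f
·Y-K₁≈up-diag N f w = trans (·-congʳ f Y-K₁≈p₁ w) (sym (up-diag N f w))

Y-on-length : ∀ {N} (H : Graph N) w (p : length w ≡ N) → Y H w ≡ ⟦ properᵇ H (colouring w p) ⟧
Y-on-length {N} H w p with length w ℕₚ.≟ N
... | yes q rewrite ℕₚ.≡-irrelevant p q = refl
... | no ¬p = ⊥-elim (¬p p)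

Y-off-length : ∀ {N} (H : Graph N) w → length w ≢ N → Y H w ≡ 0ℤ
Y-off-length {N} H w ¬p with length w ℕₚ.≟ N
... | yes p = ⊥-elim (¬p p)
... | no _  = refl

Y-length-guard : ∀ {N} (H : Graph N) u b →
                 (if (length u ≡ᵇ N) ∧ b then Y H u else 0ℤ) ≡ (if b then Y H u else 0ℤ)
Y-length-guard {N} H u b = guard (length u ℕₚ.≟ N)
  where
  if-0 : ∀ t → (if t then 0ℤ else 0ℤ) ≡ 0ℤ
  if-0 true  = refl
  if-0 false = refl
  guard : Dec (length u ≡ N) → (if (length u ≡ᵇ N) ∧ b then Y H u else 0ℤ) ≡ (if b then Y H u else 0ℤ)
  guard (yes p) = cong (λ t → if t ∧ b then Y H u else 0ℤ) (Equivalence.to T-≡ (ℕₚ.≡⇒≡ᵇ _ _ p))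
  guard (no ¬p) rewrite Y-off-length H u ¬p = trans (if-0 ((length u ≡ᵇ N) ∧ b)) (sym (if-0 b))

up-below-∷ʳ : ∀ {i m} (H : Graph m) u c → i ≤ m →
              up i (suc m) (Y H) (u ∷ʳ c) ≡ ⟦ hasLetter u c i ⟧ * Y H u
up-below-∷ʳ {i} {m} H u c i≤m = begin
  up i (suc m) (Y H) (u ∷ʳ c)                                  ≡⟨ up-below (Y H) (s≤s i≤m) (u ∷ʳ c) ⟩
  upLt i (suc m) (Y H) (u ∷ʳ c)                                ≡⟨ upLt-∷ʳ i (suc m) (Y H) u c ⟩
  (if (length u ≡ᵇ m) ∧ hasLetter u c i then Y H u else 0ℤ)   ≡⟨ Y-length-guard H u (hasLetter u c i) ⟩
  (if hasLetter u c i then Y H u else 0ℤ)                     ≡⟨ if-then-0ℤ (hasLetter u c i) (Y H u) ⟩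
  ⟦ hasLetter u c i ⟧ * Y H u                                  ∎

Σs-up-∷ʳ : ∀ {m} (H : Graph m) lo u c →
           Σs (map (λ i → up i (suc m) (Y H)) (interval lo m)) (u ∷ʳ c)
           ≡ sumℤ (map (⟦_⟧ ∘ hasLetter u c) (interval lo m)) * Y H u
Σs-up-∷ʳ {m} H lo u c = begin
  Σs (map (λ i → up i (suc m) (Y H)) I) (u ∷ʳ c)  ≡⟨ Σs-map _ I (u ∷ʳ c) ⟩
  sumℤ (map (λ i → up i (suc m) (Y H) (u ∷ʳ c)) I) ≡⟨ sumℤ-cong I (λ i∈I →
                                                       up-below-∷ʳ H u c (proj₂ (∈-interval⁻ i∈I))) ⟩
  sumℤ (map (λ i → ⟦ hasLetter u c i ⟧ * Y H u) I)  ≡⟨ sumℤ-*ʳ (⟦_⟧ ∘ hasLetter u c) (Y H u) I ⟩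
  sumℤ (map (⟦_⟧ ∘ hasLetter u c) I) * Y H u        ∎
  where I = interval lo m

Proper : ∀ {N} → Graph N → (Fin N → ℕ) → Set
Proper H κ = ∀ {i j} → i ≢ j → T (adj H i j) → κ i ≢ κ j

properᵇ⇒Proper : ∀ {N} (H : Graph N) κ → T (properᵇ H κ) → Proper H κ
properᵇ⇒Proper {N} H κ t {i} {j} i≢j ij κi≡κj = refute (pair-ok i j)
  where
  pair-ok : ∀ i j → T (does (i ≟ j) ∨ not (adj H i j) ∨ not (κ i ≡ᵇ κ j))
  pair-ok i j = All.lookup (all⁺ _ (allFin N) (All.lookup (all⁺ _ (allFin N) t) (∈-allFin i))) (∈-allFin j)
  refute : ¬ T (does (i ≟ j) ∨ not (adj H i j) ∨ not (κ i ≡ᵇ κ j))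
  refute rewrite dec-false (i ≟ j) i≢j | Equivalence.to T-≡ ij
               | Equivalence.to T-≡ (ℕₚ.≡⇒≡ᵇ _ _ κi≡κj) = λ ()

Proper⇒properᵇ : ∀ {N} (H : Graph N) κ → Proper H κ → T (properᵇ H κ)
Proper⇒properᵇ {N} H κ P =
  all⁻ _ {allFin N} (All.tabulate λ {i} _ → all⁻ _ {allFin N} (All.tabulate λ {j} _ → pair-ok i j))
  where
  pair-ok : ∀ i j → T (does (i ≟ j) ∨ not (adj H i j) ∨ not (κ i ≡ᵇ κ j))
  pair-ok i j with i ≟ j
  ... | yes _ = tt
  ... | no i≢j with adj H i j in ij
  ...   | false = tt
  ...   | true with κ i ≡ᵇ κ j in κij
  ...     | false = tt
  ...     | true  = P i≢j (Equivalence.from T-≡ ij) (ℕₚ.≡ᵇ⇒≡ _ _ (Equivalence.from T-≡ κij))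

Proper-resp-≗ : ∀ {N} (H : Graph N) {κ κ′} → κ ≗ κ′ → Proper H κ → Proper H κ′
Proper-resp-≗ H κ≗κ′ P i≢j ij κ′i≡κ′j = P i≢j ij (trans (κ≗κ′ _) (trans κ′i≡κ′j (sym (κ≗κ′ _))))

-- Vertex i lies in the k-th interval, numbering vertices from 1 as in the paper.
InInterval : ∀ {n} → (Fin n → ℕ) → Fin n → Fin n → Set
InInterval a k i = a k ≤ suc (toℕ i) × toℕ i ≤ toℕ k

module _ {n} (a : Fin n → ℕ) where

  UIG-adj⁺ : ∀ {i j} k → i ≢ j → InInterval a k i → InInterval a k j → T (adj (UIG n a) i j)
  UIG-adj⁺ {i} {j} k i≢j (aₖ≤i , i≤k) (aₖ≤j , j≤k) =
    and (subst (T ∘ not) (sym (dec-false (i ≟ j) i≢j)) tt)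
        (any⁺ _ (lose (∈-allFin k)
          (and (ℕₚ.≤⇒≤ᵇ aₖ≤i) (and (ℕₚ.≤⇒≤ᵇ (s≤s i≤k)) (and (ℕₚ.≤⇒≤ᵇ aₖ≤j) (ℕₚ.≤⇒≤ᵇ (s≤s j≤k)))))))
    where
    and : ∀ {x y} → T x → T y → T (x ∧ y)
    and tx ty = Equivalence.from T-∧ (tx , ty)

  UIG-adj⁻ : ∀ {i j} → T (adj (UIG n a) i j) → i ≢ j × ∃ λ k → InInterval a k i × InInterval a k j
  UIG-adj⁻ {i} {j} t with Equivalence.to T-∧ t
  ... | distinct , some-k with find (any⁻ _ (allFin n) some-k)
  ... | k , _ , inside with Equivalence.to T-∧ inside
  ... | c₁ , c₂₃₄ with Equivalence.to T-∧ c₂₃₄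
  ... | c₂ , c₃₄ with Equivalence.to T-∧ c₃₄
  ... | c₃ , c₄ =
    (λ i≡j → subst (T ∘ not) (dec-true (i ≟ j) i≡j) distinct) ,
    k , (ℕₚ.≤ᵇ⇒≤ _ _ c₁ , s≤s⁻¹ (ℕₚ.≤ᵇ⇒≤ _ _ c₂)) , (ℕₚ.≤ᵇ⇒≤ _ _ c₃ , s≤s⁻¹ (ℕₚ.≤ᵇ⇒≤ _ _ c₄))

  UIG-adj-sym : ∀ {i j} → T (adj (UIG n a) i j) → T (adj (UIG n a) j i)
  UIG-adj-sym t with UIG-adj⁻ t
  ... | i≢j , k , i∈k , j∈k = UIG-adj⁺ k (i≢j ∘ sym) j∈k i∈k

module LastVertex {m} (a : Fin (suc m) → ℕ) where

  G : Graph (suc m)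
  G = UIG (suc m) a

  G′ : Graph m
  G′ = deleteLast G

  aₙ : ℕ
  aₙ = a (fromℕ m)

  LastNeighbour : Fin m → Set
  LastNeighbour j = aₙ ≤ suc (toℕ j)

  LastNeighbour-inject₁ : ∀ {j} → LastNeighbour j → aₙ ≤ suc (toℕ (inject₁ j))
  LastNeighbour-inject₁ {j} = subst (λ t → aₙ ≤ suc t) (sym (Finₚ.toℕ-inject₁ j))

  InInterval-last : ∀ {i} → aₙ ≤ suc (toℕ i) → InInterval a (fromℕ m) i
  InInterval-last {i} aₙ≤i = aₙ≤i , subst (toℕ i ≤_) (sym (Finₚ.toℕ-fromℕ m)) (Finₚ.toℕ≤pred[n] i)

  InInterval-fromℕ⇒last : ∀ {k} → InInterval a k (fromℕ m) → k ≡ fromℕ m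
  InInterval-fromℕ⇒last {k} (_ , n≤k) = Finₚ.toℕ-injective (trans
    (ℕₚ.≤-antisym (Finₚ.toℕ≤pred[n] k) (subst (_≤ toℕ k) (Finₚ.toℕ-fromℕ m) n≤k))
    (sym (Finₚ.toℕ-fromℕ m)))

  tail-clique : ∀ {i j} → i ≢ j → aₙ ≤ suc (toℕ i) → aₙ ≤ suc (toℕ j) → T (adj G i j)
  tail-clique i≢j aₙ≤i aₙ≤j = UIG-adj⁺ a (fromℕ m) i≢j (InInterval-last aₙ≤i) (InInterval-last aₙ≤j)

  adj-last⇒LastNeighbour : ∀ {j} → T (adj G (inject₁ j) (fromℕ m)) → LastNeighbour j
  adj-last⇒LastNeighbour {j} t with UIG-adj⁻ a t
  ... | _ , k , j∈k , last∈k with InInterval-fromℕ⇒last last∈k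
  ... | refl = subst (λ t → aₙ ≤ suc t) (Finₚ.toℕ-inject₁ j) (proj₁ j∈k)

  LastColourFresh : (Fin (suc m) → ℕ) → Set
  LastColourFresh κ = ∀ {j} → LastNeighbour j → κ (inject₁ j) ≢ κ (fromℕ m)

  Proper-extend⇔ : aₙ ≤ suc (toℕ (fromℕ m)) → ∀ {κ} →
                   Proper G κ ⇔ (Proper G′ (κ ∘ inject₁) × LastColourFresh κ)
  Proper-extend⇔ aₙ≤n {κ} = mk⇔ restrict extend
    where
    restrict : Proper G κ → Proper G′ (κ ∘ inject₁) × LastColourFresh κ
    restrict P = (λ i≢j → P (i≢j ∘ Finₚ.inject₁-injective)) ,
                 λ nb → P j≢n (tail-clique j≢n (LastNeighbour-inject₁ nb) aₙ≤n)
      where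
      j≢n : ∀ {j} → inject₁ j ≢ fromℕ m
      j≢n = Finₚ.fromℕ≢inject₁ ∘ sym
    extend : Proper G′ (κ ∘ inject₁) × LastColourFresh κ → Proper G κ
    extend (P′ , avoid) {i} {j} i≢j ij with view i | view j
    ... | ‵inject₁ i′ | ‵inject₁ j′ = P′ (i≢j ∘ cong inject₁) ij
    ... | ‵inject₁ i′ | ‵fromℕ      = avoid (adj-last⇒LastNeighbour ij)
    ... | ‵fromℕ      | ‵inject₁ j′ = avoid (adj-last⇒LastNeighbour (UIG-adj-sym a ij)) ∘ sym
    ... | ‵fromℕ      | ‵fromℕ      = ⊥-elim (i≢j refl)

  Proper-tail-injective : ∀ {κ j j′} → Proper G′ κ → LastNeighbour j → LastNeighbour j′ → κ j ≡ κ j′ → j ≡ j′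
  Proper-tail-injective {j = j} {j′} P′ nb nb′ κj≡κj′ with j ≟ j′
  ... | yes j≡j′ = j≡j′
  ... | no  j≢j′ = ⊥-elim (P′ j≢j′
          (tail-clique (j≢j′ ∘ Finₚ.inject₁-injective) (LastNeighbour-inject₁ nb) (LastNeighbour-inject₁ nb′)) κj≡κj′)

  module _ (u : List ℕ) (c : ℕ) (p : length u ≡ m) where

    ∣u∷ʳc∣≡n : length (u ∷ʳ c) ≡ suc m
    ∣u∷ʳc∣≡n = trans (length-∷ʳ u c) (cong suc p)

    hasLetter-suc⇔ : ∀ j → T (hasLetter u c (suc (toℕ j))) ⇔ colouring u p j ≡ c
    hasLetter-suc⇔ j = subst (λ x → T (eqMaybe x c) ⇔ colouring u p j ≡ c) (sym (nth-colouring u p j))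
                         (mk⇔ (ℕₚ.≡ᵇ⇒≡ _ _) (ℕₚ.≡⇒≡ᵇ _ _))

    -- Position 0 would be read as position 1 by `i ∸ 1`; 1 ≤ aₙ keeps it out of the interval.
    letter-position : 1 ≤ aₙ → ∀ {i} → i ∈ interval aₙ m → T (hasLetter u c i) →
                      ∃ λ j → suc (toℕ j) ≡ i × LastNeighbour j × colouring u p j ≡ c
    letter-position 1≤aₙ {zero} i∈I _ with ℕₚ.≤-trans 1≤aₙ (proj₁ (∈-interval⁻ i∈I))
    ... | ()
    letter-position 1≤aₙ {suc t} i∈I letter =
      j , cong suc toℕj≡t , subst (λ s → aₙ ≤ suc s) (sym toℕj≡t) (proj₁ (∈-interval⁻ i∈I)) ,
      Equivalence.to (hasLetter-suc⇔ j) (subst (λ s → T (hasLetter u c (suc s))) (sym toℕj≡t) letter)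
      where
      j : Fin m
      j = fromℕ< (proj₂ (∈-interval⁻ i∈I))
      toℕj≡t : toℕ j ≡ t
      toℕj≡t = Finₚ.toℕ-fromℕ< _

    any-hasLetter⇔ : 1 ≤ aₙ →
                     T (any (hasLetter u c) (interval aₙ m)) ⇔ ∃ λ j → LastNeighbour j × colouring u p j ≡ c
    any-hasLetter⇔ 1≤aₙ = mk⇔ to from
      where
      to : T (any (hasLetter u c) (interval aₙ m)) → ∃ λ j → LastNeighbour j × colouring u p j ≡ c
      to t with find (any⁻ _ (interval aₙ m) t)
      ... | i , i∈I , letter with letter-position 1≤aₙ i∈I letter
      ... | j , _ , nb , κj≡c = j , nb , κj≡c
      from : (∃ λ j → LastNeighbour j × colouring u p j ≡ c) → T (any (hasLetter u c) (interval aₙ m))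
      from (j , nb , κj≡c) =
        any⁺ _ (lose (∈-interval⁺ nb (Finₚ.toℕ<n j)) (Equivalence.from (hasLetter-suc⇔ j) κj≡c))

    hasLetter-at-most-once : 1 ≤ aₙ → Proper G′ (colouring u p) →
                             ∀ {x y} → x ∈ interval aₙ m → y ∈ interval aₙ m →
                             T (hasLetter u c x) → T (hasLetter u c y) → x ≡ y
    hasLetter-at-most-once 1≤aₙ P′ x∈I y∈I x-letter y-letter
      with letter-position 1≤aₙ x∈I x-letter | letter-position 1≤aₙ y∈I y-letter
    ... | j , refl , nb , κj≡c | j′ , refl , nb′ , κj′≡c =
      cong (suc ∘ toℕ) (Proper-tail-injective P′ nb nb′ (trans κj≡c (sym κj′≡c)))

    properᵇ-∷ʳ : 1 ≤ aₙ → aₙ ≤ suc (toℕ (fromℕ m)) →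
                 properᵇ G (colouring (u ∷ʳ c) ∣u∷ʳc∣≡n)
                 ≡ properᵇ G′ (colouring u p) ∧ not (any (hasLetter u c) (interval aₙ m))
    properᵇ-∷ʳ 1≤aₙ aₙ≤n = T-ext forward backward
      where
      κ  = colouring (u ∷ʳ c) ∣u∷ʳc∣≡n
      κ′ = colouring u p
      restriction : κ ∘ inject₁ ≗ κ′
      restriction = colouring-∷ʳ-inject₁ u c p ∣u∷ʳc∣≡n
      κₙ≡c : κ (fromℕ m) ≡ c
      κₙ≡c = colouring-∷ʳ-fromℕ u c p ∣u∷ʳc∣≡n
      witness : T (any (hasLetter u c) (interval aₙ m)) → ∃ λ j → LastNeighbour j × colouring u p j ≡ c
      witness = Equivalence.to (any-hasLetter⇔ 1≤aₙ)
      fresh⇒no-letter : LastColourFresh κ → ¬ T (any (hasLetter u c) (interval aₙ m))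
      fresh⇒no-letter fresh letter with witness letter
      ... | j , nb , κ′j≡c = fresh nb (trans (restriction j) (trans κ′j≡c (sym κₙ≡c)))
      no-letter⇒fresh : ¬ T (any (hasLetter u c) (interval aₙ m)) → LastColourFresh κ
      no-letter⇒fresh no-letter {j} nb κj≡κₙ = no-letter (Equivalence.from (any-hasLetter⇔ 1≤aₙ)
        (j , nb , trans (sym (restriction j)) (trans κj≡κₙ κₙ≡c)))
      forward : T (properᵇ G κ) → T (properᵇ G′ κ′ ∧ not (any (hasLetter u c) (interval aₙ m)))
      forward t with Equivalence.to (Proper-extend⇔ aₙ≤n) (properᵇ⇒Proper G κ t)
      ... | P′ , fresh = T-∧-not⁺ (Proper⇒properᵇ G′ κ′ (Proper-resp-≗ G′ restriction P′)) (fresh⇒no-letter fresh)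
      backward : T (properᵇ G′ κ′ ∧ not (any (hasLetter u c) (interval aₙ m))) → T (properᵇ G κ)
      backward t with T-∧-not⁻ t
      ... | t′ , no-letter = Proper⇒properᵇ G κ (Equivalence.from (Proper-extend⇔ aₙ≤n)
        (Proper-resp-≗ G′ (sym ∘ restriction) (properᵇ⇒Proper G′ κ′ t′) , no-letter⇒fresh no-letter))

  Y-∷ʳ : 1 ≤ aₙ → aₙ ≤ suc (toℕ (fromℕ m)) → ∀ u c →
         Y G (u ∷ʳ c) ≡ Y G′ u - sumℤ (map (⟦_⟧ ∘ hasLetter u c) (interval aₙ m)) * Y G′ u
  Y-∷ʳ 1≤aₙ aₙ≤n u c = by-length (length u ℕₚ.≟ m)
    where
    s : ℤ
    s = sumℤ (map (⟦_⟧ ∘ hasLetter u c) (interval aₙ m))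
    by-length : Dec (length u ≡ m) → Y G (u ∷ʳ c) ≡ Y G′ u - s * Y G′ u
    by-length (no ∣u∣≢m) = begin
      Y G (u ∷ʳ c)         ≡⟨ Y-off-length G (u ∷ʳ c) (∣u∣≢m ∘ ℕₚ.suc-injective ∘ trans (sym (length-∷ʳ u c))) ⟩
      0ℤ - 0ℤ              ≡⟨ cong (0ℤ -_) (sym (ℤₚ.*-zeroʳ s)) ⟩
      0ℤ - s * 0ℤ          ≡⟨ cong (λ y → y - s * y) (sym (Y-off-length G′ u ∣u∣≢m)) ⟩
      Y G′ u - s * Y G′ u  ∎
    by-length (yes p) = begin
      Y G (u ∷ʳ c)
        ≡⟨ Y-on-length G (u ∷ʳ c) (∣u∷ʳc∣≡n u c p) ⟩
      ⟦ properᵇ G (colouring (u ∷ʳ c) (∣u∷ʳc∣≡n u c p)) ⟧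
        ≡⟨ cong ⟦_⟧ (properᵇ-∷ʳ u c p 1≤aₙ aₙ≤n) ⟩
      ⟦ properᵇ G′ κ′ ∧ not (any (hasLetter u c) (interval aₙ m)) ⟧
        ≡⟨ ⟦∧not⟧ _ _ (λ proper → sumℤ-⟦⟧≡⟦any⟧ (hasLetter u c) (interval-unique aₙ m)
                                     (hasLetter-at-most-once u c p 1≤aₙ (properᵇ⇒Proper G′ κ′ proper))) ⟩
      ⟦ properᵇ G′ κ′ ⟧ - s * ⟦ properᵇ G′ κ′ ⟧
        ≡⟨ cong (λ y → y - s * y) (sym (Y-on-length G′ u p)) ⟩
      Y G′ u - s * Y G′ u ∎
      where κ′ = colouring u p

·Y-K₁-∷ʳ : ∀ f u c → (f · Y K₁) (u ∷ʳ c) ≡ f u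
·Y-K₁-∷ʳ f u c = trans (·-congʳ f Y-K₁≈p₁ (u ∷ʳ c)) (·p₁-∷ʳ f u c)

theorem3p1 : (m : ℕ) (a : Fin (suc m) → ℕ) → (∀ k → 1 ≤ a k × a k ≤ suc (toℕ k)) →
    (Y (UIG (suc m) a) ≈ Y (deleteLast (UIG (suc m) a)) · Y K₁ ⊖ Σs (map (λ i → up i (suc m) (Y (deleteLast (UIG (suc m) a)))) (interval (a (fromℕ m)) m)))
    × (Y (deleteLast (UIG (suc m) a)) · Y K₁ ⊖ Σs (map (λ i → up i (suc m) (Y (deleteLast (UIG (suc m) a)))) (interval (a (fromℕ m)) m))
    ≈ up (suc m) (suc m) (Y (deleteLast (UIG (suc m) a))) ⊖ Σs (map (λ i → up i (suc m) (Y (deleteLast (UIG (suc m) a)))) (interval (a (fromℕ m)) m)))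
theorem3p1 m a bounds = coefficients , λ w → cong (_- Σup w) (·Y-K₁≈up-diag (suc m) F w)
  where
  open LastVertex a
  F : NCSeries
  F = Y G′
  Σup : NCSeries
  Σup = Σs (map (λ i → up i (suc m) F) (interval aₙ m))
  coefficients : Y G ≈ F · Y K₁ ⊖ Σup
  coefficients w with initLast w
  ... | [] = sym (cong₂ _-_ (trans (·Y-K₁≈up-diag (suc m) F []) (up-[] (suc m) (suc m) F))
                            (trans (Σs-map _ (interval aₙ m) []) (sumℤ-zero (interval aₙ m) λ {i} _ → up-[] i (suc m) F)))
  ... | u ∷ʳ′ c = begin
    Y G (u ∷ʳ c)                                                        ≡⟨ Y-∷ʳ (proj₁ (bounds (fromℕ m))) (proj₂ (bounds (fromℕ m))) u c ⟩
    F u - sumℤ (map (⟦_⟧ ∘ hasLetter u c) (interval aₙ m)) * F u         ≡⟨ sym (cong₂ _-_ (·Y-K₁-∷ʳ F u c) (Σs-up-∷ʳ G′ aₙ u c)) ⟩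
    (F · Y K₁ ⊖ Σup) (u ∷ʳ c)                                           ∎
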